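{- Let $\mathcal{M}$ be a labeling of a finite atomic lattice $P$. If $p\in P$, $R\in B_p$ and $b$ is an atom with $b\in\mathrm{supp}(p)\setminus R$, then $\triangle(b)$ divides $\mathrm{lcm}\{\triangle(r): r\in R\}$.
   Context: A finite atomic lattice is a finite lattice $P$ with least element $0$ and greatest element in which every nonzero element is a join of atoms; $\mathrm{atoms}(P)$ is its set of atoms, and $\mathrm{supp}(p)=\{a\in\mathrm{atoms}(P): a\le p\}$. For $p\in P$, $\lceil p\rceil=\{q: q\ge p\}$ and $\lceil p\rceil^c=P\setminus\lceil p\rceil$. A labeling $\mathcal{M}$ of $P$ assigns a monomial $m_p$ (in a polynomial ring over a field) to each $p\in P$, unlabeled elements having label $1$. Conventions: $\mathrm{lcm}\,\emptyset=\gcd\emptyset=1$. For $a\in\mathrm{atoms}(P)$ let $x(a)=\prod_{p\in\lceil a\rceil^c}m_p$. For $p\in P$ let $B_p=\{T\subseteq\mathrm{supp}(p): \bigvee_{b\in T}b=p\}$, and for $a\in\mathrm{atoms}(P)$ let $\triangle(a)=\gcd\{\mathrm{lcm}\{x(b):b\in T\}: T\in\bigcup_{q\ge a}B_q\}$. -}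

module Defs where

open import Data.Nat using (ℕ; zero; suc; _+_; _≤_; _⊔_; _⊓_)
open import Data.Fin using (Fin; _≟_)
open import Data.Fin.Properties using (all?)
open import Data.Fin.Subset using (Subset; _∈_; inside; outside)
open import Data.Fin.Subset.Properties using (_∈?_)
open import Data.Vec using ([]; _∷_)
open import Data.List using (List; []; _∷_; foldr; map; concatMap; filter; allFin)
open import Data.Product using (Σ; _×_; _,_; ∃)
open import Data.Sum using (_⊎_)
open import Data.Bool using (if_then_else_)
open import Relation.Nullary using (¬_; Dec; does; ¬?)
open import Relation.Nullary.Decidable using (_×-dec_; _⊎-dec_; _→-dec_)
open import Relation.Binary using (Rel; Decidable)
open import Relation.Binary.PropositionalEquality using (_≡_; _≢_)
open import Relation.Binary.Lattice.Structures using (IsBoundedLattice)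
open import Level using (0ℓ)

-- Monomials in k variables (over any field): exponent vectors.
-- Product = pointwise +, lcm = pointwise max, gcd = pointwise min,
-- 1 = zero exponent vector, divisibility = pointwise ≤.

Mono : ℕ → Set
Mono k = Fin k → ℕ

one : ∀ {k} → Mono k
one _ = 0

_·_ : ∀ {k} → Mono k → Mono k → Mono k
(u · v) i = u i + v i

lcm₂ : ∀ {k} → Mono k → Mono k → Mono k
lcm₂ u v i = u i ⊔ v i

gcd₂ : ∀ {k} → Mono k → Mono k → Mono k
gcd₂ u v i = u i ⊓ v i

_∣ₘ_ : ∀ {k} → Mono k → Mono k → Set
u ∣ₘ v = ∀ i → u i ≤ v i

lcmL : ∀ {k} → List (Mono k) → Mono k
lcmL = foldr lcm₂ one

gcdL : ∀ {k} → List (Mono k) → Mono k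
gcdL [] = one
gcdL (u ∷ us) = foldr gcd₂ u us

subsets : ∀ n → List (Subset n)
subsets zero = [] ∷ []
subsets (suc n) = concatMap (λ s → (inside ∷ s) ∷ (outside ∷ s) ∷ []) (subsets n)

-- A finite bounded lattice, with carrier Fin N (any finite lattice is
-- isomorphic to one of this form), and decidable order.

record FiniteBoundedLattice (N : ℕ) : Set₁ where
  field
    _≼_ : Rel (Fin N) 0ℓ
    _≼?_ : Decidable _≼_
    _∨_ : Fin N → Fin N → Fin N
    _∧_ : Fin N → Fin N → Fin N
    ⊤ : Fin N
    ⊥ : Fin N
    isBoundedLattice : IsBoundedLattice _≡_ _≼_ _∨_ _∧_ ⊤ ⊥

module _ {N : ℕ} (L : FiniteBoundedLattice N) where
  open FiniteBoundedLattice L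

  IsAtom : Fin N → Set
  IsAtom a = (a ≢ ⊥) × (∀ q → q ≼ a → (q ≡ ⊥) ⊎ (q ≡ a))

  isAtom? : (a : Fin N) → Dec (IsAtom a)
  isAtom? a = ¬? (a ≟ ⊥) ×-dec all? (λ q → (q ≼? a) →-dec ((q ≟ ⊥) ⊎-dec (q ≟ a)))

  ⋁ : Subset N → Fin N
  ⋁ T = foldr (λ i acc → if does (i ∈? T) then i ∨ acc else acc) ⊥ (allFin N)

  IsAtomic : Set
  IsAtomic = ∀ p → p ≢ ⊥ → ∃ λ (T : Subset N) → (∀ i → i ∈ T → IsAtom i) × (⋁ T ≡ p)

  -- T ∈ B_p : T ⊆ supp(p) and ⋁ T = p
  InB : Fin N → Subset N → Set
  InB p T = (∀ i → i ∈ T → IsAtom i × (i ≼ p)) × (⋁ T ≡ p)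

  inB? : (p : Fin N) (T : Subset N) → Dec (InB p T)
  inB? p T = all? (λ i → (i ∈? T) →-dec (isAtom? i ×-dec (i ≼? p))) ×-dec (⋁ T ≟ p)

  lcmS : ∀ {k} → Subset N → (Fin N → Mono k) → Mono k
  lcmS T f = lcmL (map f (filter (λ i → i ∈? T) (allFin N)))

  module _ {k : ℕ} (m : Fin N → Mono k) where

    x : Fin N → Mono k
    x a = foldr _·_ one (map m (filter (λ p → ¬? (a ≼? p)) (allFin N)))

    Bsets≥ : Fin N → List (Subset N)
    Bsets≥ a = concatMap
      (λ q → if does (a ≼? q) then filter (λ T → inB? q T) (subsets N) else [])
      (allFin N)

    △ : Fin N → Mono k
    △ a = gcdL (map (λ T → lcmS T x) (Bsets≥ a))

-- Fix a coordinate i of the exponent vectors. For each r ∈ R pick, among the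
-- sets T ∈ ⋃_{q ≥ r} B_q, one minimising the i-th exponent of lcm{x(j) : j ∈ T};
-- that minimum is the i-th exponent of △(r). The union U of the chosen sets
-- consists of atoms, so U ∈ B_{⋁U}, and ⋁U lies above every r ∈ R, hence above
-- p = ⋁R ≥ b. Thus U is one of the sets in the gcd defining △(b), and the i-th
-- exponent of lcm{x(j) : j ∈ U} is the largest of the chosen minima.
module Submission where

open import Defs
open import Data.Nat using (ℕ; suc; _≤_; z≤n)
open import Data.Nat.Properties
  using (≤-refl; ≤-trans; m≤m⊔n; m≤n⊔m; ⊔-lub; ⊓-glb; m⊓n≤m; m⊓n≤n)
open import Data.Fin using (Fin)
open import Data.Fin.Subset using (Subset; _∈_; _∉_; _⊆_; inside; outside; ⋃)
open import Data.Fin.Subset.Properties using (_∈?_; ∉⊥; x∈p∪q⁺; x∈p∪q⁻)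
open import Data.Vec using ([]; _∷_)
open import Data.List using (List; []; _∷_; foldr; map; filter; allFin)
open import Data.List.Extrema.Nat using (argmin; argmin-all; f[argmin]≤f[xs])
open import Data.List.Membership.Propositional using () renaming (_∈_ to _∈ₗ_)
open import Data.List.Membership.Propositional.Properties
  using (∈-map⁺; ∈-map⁻; ∈-filter⁺; ∈-filter⁻; ∈-concatMap⁺; ∈-concatMap⁻; ∈-allFin)
open import Data.List.Relation.Unary.All as All using ()
open import Data.List.Relation.Unary.Any as Any using (here; there)
open import Data.Product using (∃; _×_; _,_; proj₁; proj₂)
open import Data.Sum using (inj₁; inj₂)
open import Data.Bool using (if_then_else_)
open import Function using (_∘_)
open import Relation.Nullary using (yes; no; does; contradiction)
open import Relation.Binary.PropositionalEquality using (refl)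
open import Relation.Binary.Lattice.Structures using (IsBoundedLattice)

module _ {k : ℕ} where

  lcmL-upper : ∀ {u : Mono k} {us} → u ∈ₗ us → u ∣ₘ lcmL us
  lcmL-upper {u} {_ ∷ us} (here refl) i = m≤m⊔n (u i) (lcmL us i)
  lcmL-upper {_} {v ∷ us} (there u∈us) i =
    ≤-trans (lcmL-upper u∈us i) (m≤n⊔m (v i) (lcmL us i))

  lcmL-least : ∀ {us c} (i : Fin k) → (∀ {u} → u ∈ₗ us → u i ≤ c) → lcmL us i ≤ c
  lcmL-least {[]} i _ = z≤n
  lcmL-least {_ ∷ _} i bound = ⊔-lub (bound (here refl)) (lcmL-least i (bound ∘ there))

  foldr-gcd₂-∣ₘ-seed : ∀ (v : Mono k) us → foldr gcd₂ v us ∣ₘ v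
  foldr-gcd₂-∣ₘ-seed v [] i = ≤-refl
  foldr-gcd₂-∣ₘ-seed v (w ∷ us) i = ≤-trans (m⊓n≤n (w i) _) (foldr-gcd₂-∣ₘ-seed v us i)

  foldr-gcd₂-∣ₘ : ∀ {v w : Mono k} {us} → w ∈ₗ us → foldr gcd₂ v us ∣ₘ w
  foldr-gcd₂-∣ₘ (here refl) i = m⊓n≤m _ _
  foldr-gcd₂-∣ₘ (there w∈us) i = ≤-trans (m⊓n≤n _ _) (foldr-gcd₂-∣ₘ w∈us i)

  foldr-gcd₂-greatest : ∀ {v us c} (i : Fin k) → c ≤ v i → (∀ {w} → w ∈ₗ us → c ≤ w i) →
                        c ≤ foldr gcd₂ v us i
  foldr-gcd₂-greatest {us = []} i c≤v _ = c≤v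
  foldr-gcd₂-greatest {us = _ ∷ _} i c≤v bound =
    ⊓-glb (bound (here refl)) (foldr-gcd₂-greatest i c≤v (bound ∘ there))

  gcdL-lower : ∀ {u us} → u ∈ₗ us → gcdL us ∣ₘ u
  gcdL-lower {us = v ∷ us} (here refl) = foldr-gcd₂-∣ₘ-seed v us
  gcdL-lower (there u∈us) = foldr-gcd₂-∣ₘ u∈us

  gcdL-greatest : ∀ {u us c} (i : Fin k) → u ∈ₗ us → (∀ {v} → v ∈ₗ us → c ≤ v i) →
                  c ≤ gcdL us i
  gcdL-greatest {us = _ ∷ _} i _ bound =
    foldr-gcd₂-greatest i (bound (here refl)) (bound ∘ there)

private
  extensions : ∀ {n} → Subset n → List (Subset (suc n))
  extensions s = (inside ∷ s) ∷ (outside ∷ s) ∷ []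

∈-subsets : ∀ {n} (T : Subset n) → T ∈ₗ subsets n
∈-subsets [] = here refl
∈-subsets (inside ∷ T) =
  ∈-concatMap⁺ extensions (Any.map (λ { refl → here refl }) (∈-subsets T))
∈-subsets (outside ∷ T) =
  ∈-concatMap⁺ extensions (Any.map (λ { refl → there (here refl) }) (∈-subsets T))

module _ {n : ℕ} {x : Fin n} where

  x∈⋃⁺ : ∀ {p ps} → p ∈ₗ ps → x ∈ p → x ∈ ⋃ ps
  x∈⋃⁺ (here refl) x∈p = x∈p∪q⁺ (inj₁ x∈p)
  x∈⋃⁺ (there p∈ps) x∈p = x∈p∪q⁺ (inj₂ (x∈⋃⁺ p∈ps x∈p))

  x∈⋃⁻ : ∀ ps → x ∈ ⋃ ps → ∃ λ p → p ∈ₗ ps × x ∈ p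
  x∈⋃⁻ [] x∈⊥ = contradiction x∈⊥ ∉⊥
  x∈⋃⁻ (p ∷ ps) x∈⋃ with x∈p∪q⁻ p (⋃ ps) x∈⋃
  ... | inj₁ x∈p = p , here refl , x∈p
  ... | inj₂ x∈⋃ps with x∈⋃⁻ ps x∈⋃ps
  ...   | q , q∈ps , x∈q = q , there q∈ps , x∈q

elements : ∀ {n} → Subset n → List (Fin n)
elements R = filter (_∈? R) (allFin _)

∈-elements⁺ : ∀ {n} {R : Subset n} {i} → i ∈ R → i ∈ₗ elements R
∈-elements⁺ {R = R} {i} = ∈-filter⁺ (_∈? R) (∈-allFin i)

∈-elements⁻ : ∀ {n} {R : Subset n} {i} → i ∈ₗ elements R → i ∈ R
∈-elements⁻ {R = R} = proj₂ ∘ ∈-filter⁻ (_∈? R) {xs = allFin _}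

module _ {N : ℕ} (L : FiniteBoundedLattice N) where
  open FiniteBoundedLattice L
  open IsBoundedLattice isBoundedLattice using (minimum; supremum) renaming (trans to ≼-trans)

  private
    joinOver : Subset N → List (Fin N) → Fin N
    joinOver T = foldr (λ j acc → if does (j ∈? T) then j ∨ acc else acc) ⊥

    joinOver-upper : ∀ {T j} js → j ∈ₗ js → j ∈ T → j ≼ joinOver T js
    joinOver-upper {T} (a ∷ js) j∈ j∈T with a ∈? T | j∈
    ... | yes _ | here refl = proj₁ (supremum a (joinOver T js))
    ... | yes _ | there j∈js =
      ≼-trans (joinOver-upper js j∈js j∈T) (proj₁ (proj₂ (supremum a (joinOver T js))))
    ... | no a∉T | here refl = contradiction j∈T a∉T
    ... | no _ | there j∈js = joinOver-upper js j∈js j∈T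

    joinOver-least : ∀ {T u} js → (∀ {j} → j ∈ T → j ≼ u) → joinOver T js ≼ u
    joinOver-least [] _ = minimum _
    joinOver-least {T} {u} (a ∷ js) bound with a ∈? T
    ... | yes a∈T =
      proj₂ (proj₂ (supremum a (joinOver T js))) u (bound a∈T) (joinOver-least js bound)
    ... | no _ = joinOver-least js bound

  ⋁-upper : ∀ {T j} → j ∈ T → j ≼ ⋁ L T
  ⋁-upper {j = j} = joinOver-upper (allFin N) (∈-allFin j)

  ⋁-least : ∀ {T u} → (∀ {j} → j ∈ T → j ≼ u) → ⋁ L T ≼ u
  ⋁-least = joinOver-least (allFin N)

  ⋁-mono : ∀ {T U} → T ⊆ U → ⋁ L T ≼ ⋁ L U
  ⋁-mono T⊆U = ⋁-least (⋁-upper ∘ T⊆U)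

  InB-⋃ : ∀ {Ts} → (∀ {T} → T ∈ₗ Ts → ∃ λ q → InB L q T) → InB L (⋁ L (⋃ Ts)) (⋃ Ts)
  InB-⋃ {Ts} inB = atomsBelow , refl
    where
    atomsBelow : ∀ j → j ∈ ⋃ Ts → IsAtom L j × (j ≼ ⋁ L (⋃ Ts))
    atomsBelow j j∈⋃ with x∈⋃⁻ Ts j∈⋃
    ... | T , T∈Ts , j∈T = proj₁ (proj₁ (proj₂ (inB T∈Ts)) j j∈T) , ⋁-upper j∈⋃

  module _ {k : ℕ} where

    lcmS-upper : ∀ {T j} (f : Fin N → Mono k) → j ∈ T → f j ∣ₘ lcmS L T f
    lcmS-upper {T} f j∈T = lcmL-upper (∈-map⁺ f (∈-elements⁺ {R = T} j∈T))

    lcmS-least : ∀ {T c} {f : Fin N → Mono k} (i : Fin k) → (∀ {j} → j ∈ T → f j i ≤ c) →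
                 lcmS L T f i ≤ c
    lcmS-least {T} {c} {f} i bound = lcmL-least i below
      where
      below : ∀ {u} → u ∈ₗ map f (elements T) → u i ≤ c
      below u∈ with ∈-map⁻ f u∈
      ... | j , j∈T , refl = bound (∈-elements⁻ j∈T)

    lcmS-⋃-least : ∀ {Ts c} {f : Fin N → Mono k} (i : Fin k) →
                   (∀ {T} → T ∈ₗ Ts → lcmS L T f i ≤ c) → lcmS L (⋃ Ts) f i ≤ c
    lcmS-⋃-least {Ts} {f = f} i bound = lcmS-least i below
      where
      below : ∀ {j} → j ∈ ⋃ Ts → f j i ≤ _
      below j∈⋃ with x∈⋃⁻ Ts j∈⋃
      ... | T , T∈Ts , j∈T = ≤-trans (lcmS-upper f j∈T i) (bound T∈Ts)

  module _ {k : ℕ} (m : Fin N → Mono k) where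

    private
      branch : Fin N → Fin N → List (Subset N)
      branch a q = if does (a ≼? q) then filter (inB? L q) (subsets N) else []

    ∈-Bsets≥⁺ : ∀ {a q T} → a ≼ q → InB L q T → T ∈ₗ Bsets≥ L m a
    ∈-Bsets≥⁺ {a} {q} {T} a≼q T∈Bq =
      ∈-concatMap⁺ (branch a) (Any.map (λ { refl → T∈branch }) (∈-allFin q))
      where
      T∈branch : T ∈ₗ branch a q
      T∈branch with a ≼? q
      ... | yes _ = ∈-filter⁺ (inB? L q) (∈-subsets T) T∈Bq
      ... | no a⋠q = contradiction a≼q a⋠q

    ∈-Bsets≥⁻ : ∀ {a T} → T ∈ₗ Bsets≥ L m a → ∃ λ q → a ≼ q × InB L q T
    ∈-Bsets≥⁻ {a} {T} T∈ with Any.satisfied (∈-concatMap⁻ (branch a) {xs = allFin N} T∈)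
    ... | q , T∈branch = q , fromBranch T∈branch
      where
      fromBranch : T ∈ₗ branch a q → a ≼ q × InB L q T
      fromBranch T∈branch with a ≼? q
      ... | yes a≼q = a≼q , proj₂ (∈-filter⁻ (inB? L q) {xs = subsets N} T∈branch)
      ... | no _ with () ← T∈branch

    ⋃-∈-Bsets≥ : ∀ {p R b} (choice : Fin N → Subset N) → InB L p R → b ≼ p →
                 (∀ {r} → r ∈ R → choice r ∈ₗ Bsets≥ L m r) →
                 ⋃ (map choice (elements R)) ∈ₗ Bsets≥ L m b
    ⋃-∈-Bsets≥ {p} {R} {b} choice R∈Bp b≼p choice∈ =
      ∈-Bsets≥⁺ (≼-trans b≼p p≼⋁U) (InB-⋃ chosen-InB)
      where
      U : Subset N
      U = ⋃ (map choice (elements R))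

      chosen-InB : ∀ {T} → T ∈ₗ map choice (elements R) → ∃ λ q → InB L q T
      chosen-InB T∈ with ∈-map⁻ choice T∈
      ... | r , r∈R , refl with ∈-Bsets≥⁻ (choice∈ (∈-elements⁻ r∈R))
      ...   | q , _ , Tr∈Bq = q , Tr∈Bq

      r≼⋁U : ∀ {r} → r ∈ R → r ≼ ⋁ L U
      r≼⋁U r∈R with ∈-Bsets≥⁻ (choice∈ r∈R)
      ... | q , r≼q , _ , refl =
        ≼-trans r≼q (⋁-mono (x∈⋃⁺ (∈-map⁺ choice (∈-elements⁺ r∈R))))

      p≼⋁U : p ≼ ⋁ L U
      p≼⋁U with refl ← proj₂ R∈Bp = ⋁-least r≼⋁U

    △-∣ₘ-lcmS : ∀ {p R b} → InB L p R → b ≼ p → △ L m b ∣ₘ lcmS L R (△ L m)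
    △-∣ₘ-lcmS {R = R} {b} R∈Bp b≼p i =
      ≤-trans (gcdL-lower (∈-map⁺ cost-vector U∈Bsets≥) i) (lcmS-⋃-least i cheapest-bounded)
      where
      cost-vector : Subset N → Mono k
      cost-vector T = lcmS L T (x L m)

      cost : Subset N → ℕ
      cost T = cost-vector T i

      cheapest : Fin N → Subset N
      cheapest r = argmin cost R (Bsets≥ L m r)

      R∈Bsets≥ : ∀ {r} → r ∈ R → R ∈ₗ Bsets≥ L m r
      R∈Bsets≥ {r} r∈R = ∈-Bsets≥⁺ (proj₂ (proj₁ R∈Bp r r∈R)) R∈Bp

      cheapest-∈ : ∀ {r} → r ∈ R → cheapest r ∈ₗ Bsets≥ L m r
      cheapest-∈ r∈R = argmin-all cost (R∈Bsets≥ r∈R) (All.tabulate (λ T∈ → T∈))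

      cheapest-≤-△ : ∀ {r} → r ∈ R → cost (cheapest r) ≤ △ L m r i
      cheapest-≤-△ {r} r∈R = gcdL-greatest i (∈-map⁺ cost-vector (R∈Bsets≥ r∈R)) below
        where
        below : ∀ {v} → v ∈ₗ map cost-vector (Bsets≥ L m r) → cost (cheapest r) ≤ v i
        below v∈ with ∈-map⁻ cost-vector v∈
        ... | T , T∈ , refl = All.lookup (f[argmin]≤f[xs] R (Bsets≥ L m r)) T∈

      U∈Bsets≥ : ⋃ (map cheapest (elements R)) ∈ₗ Bsets≥ L m b
      U∈Bsets≥ = ⋃-∈-Bsets≥ cheapest R∈Bp b≼p cheapest-∈

      cheapest-bounded : ∀ {T} → T ∈ₗ map cheapest (elements R) → cost T ≤ lcmS L R (△ L m) i
      cheapest-bounded T∈ with ∈-map⁻ cheapest T∈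
      ... | r , r∈ , refl with r∈R ← ∈-elements⁻ r∈ =
        ≤-trans (cheapest-≤-△ r∈R) (lcmS-upper (△ L m) r∈R i)

lemma3p2 : ∀ {N k : ℕ} (L : FiniteBoundedLattice N) → IsAtomic L
    → (m : Fin N → Mono k)
    → (p : Fin N) (R : Subset N) → InB L p R
    → (b : Fin N) → IsAtom L b → FiniteBoundedLattice._≼_ L b p → b ∉ R
    → △ L m b ∣ₘ lcmS L R (△ L m)
lemma3p2 L _ m p R R∈Bp b _ b≼p _ = △-∣ₘ-lcmS L m R∈Bp b≼p
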